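{- Let $F=(X,R,R_1,\ldots,R_l)$ be a frame with $l+1$ binary relations whose logic is $2$-finite. Then there is $m<\omega$ such that for every $k\le\omega$, every $k$-valuation $\theta$ in $F$ with model $M=(F,\theta)$, every formula $\xi$ in variables $p_i$ ($i<k$), every modal-free formula $\varphi$ in variables $p_i$ ($i<k$), and every $a\in V=\bar\theta(\xi)$, we have $$M,a\models[\Box_0^{\le m}\varphi]_\xi \iff R_V^*(a)\subseteq\bar\theta(\varphi).$$
   Context: The modalities are $\Diamond_0,\Diamond_1,\ldots,\Diamond_l$, interpreted by $R,R_1,\ldots,R_l$ respectively; $\Box_0=\neg\Diamond_0\neg$, $\Diamond_0^0\psi=\psi$, $\Diamond_0^{i+1}\psi=\Diamond_0^i\Diamond_0\psi$, $\Diamond_0^{\le m}\psi=\bigvee_{i\le m}\Diamond_0^i\psi$, $\Box_0^{\le m}\psi=\neg\Diamond_0^{\le m}\neg\psi$. A $k$-valuation assigns subsets of $X$ to $p_i$, $i<k$; $\bar\theta(\psi)$ is the set of points where $\psi$ is true in $(F,\theta)$. A formula is modal-free if it uses only Boolean connectives. The logic of $F$ is the set of formulas valid in $F$; it is $2$-finite if there are only finitely many formulas in $p_0,p_1$ pairwise non-equivalent modulo it. For $V\subseteq X$, $R_V=R\cap(V\times V)$ and $R_V^*$ is its reflexive transitive closure on $V$. The relativization $[\psi]_\xi$ is defined by: $[\bot]_\xi=\bot$, $[p]_\xi=p$, $[\psi_1\to\psi_2]_\xi=[\psi_1]_\xi\to[\psi_2]_\xi$, $[\Diamond\psi]_\xi=\Diamond(\xi\wedge[\psi]_\xi)$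 for every modality $\Diamond$. -}

module Defs where

open import Data.Nat using (ℕ; zero; suc)
open import Data.Fin using (Fin; toℕ) renaming (zero to fzero)
open import Data.Product using (Σ; _×_; _,_)
open import Data.Empty using (⊥)
open import Data.List using (List)
open import Data.List.Relation.Unary.Any using (Any)
open import Relation.Nullary using (¬_)
open import Relation.Binary.Construct.Closure.ReflexiveTransitive using (Star)

data Card : Set where
  fin   : ℕ → Card
  omega : Card

Var : Card → Set
Var (fin n) = Fin n
Var omega   = ℕ

-- Formulas with modalities ◇_0,…,◇_l (indexed by Fin (suc l)),
-- over variables from V; primitives ⊥, →, ◇_j.
data Fm (l : ℕ) (V : Set) : Set where
  var  : V → Fm l V
  ⊥'   : Fm l V
  _⇒_  : Fm l V → Fm l V → Fm l V
  ◇    : Fin (suc l) → Fm l V → Fm l V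

infixr 5 _⇒_

module _ {l : ℕ} {V : Set} where
  ¬'_ : Fm l V → Fm l V
  ¬' ψ = ψ ⇒ ⊥'

  _∨'_ : Fm l V → Fm l V → Fm l V
  ψ ∨' χ = (¬' ψ) ⇒ χ

  _∧'_ : Fm l V → Fm l V → Fm l V
  ψ ∧' χ = ¬' (ψ ⇒ ¬' χ)

  _⇔'_ : Fm l V → Fm l V → Fm l V
  ψ ⇔' χ = (ψ ⇒ χ) ∧' (χ ⇒ ψ)

  ◇₀^ : ℕ → Fm l V → Fm l V
  ◇₀^ zero    ψ = ψ
  ◇₀^ (suc i) ψ = ◇₀^ i (◇ fzero ψ)

  ◇₀≤ : ℕ → Fm l V → Fm l V
  ◇₀≤ zero    ψ = ◇₀^ zero ψ
  ◇₀≤ (suc m) ψ = ◇₀≤ m ψ ∨' ◇₀^ (suc m) ψ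

  □₀≤ : ℕ → Fm l V → Fm l V
  □₀≤ m ψ = ¬' (◇₀≤ m (¬' ψ))

  rel : Fm l V → Fm l V → Fm l V
  rel ξ (var p)   = var p
  rel ξ ⊥'        = ⊥'
  rel ξ (ψ ⇒ χ)   = rel ξ ψ ⇒ rel ξ χ
  rel ξ (◇ j ψ)   = ◇ j (ξ ∧' rel ξ ψ)

  data ModalFree : Fm l V → Set where
    mf-var : ∀ p → ModalFree (var p)
    mf-⊥   : ModalFree ⊥'
    mf-⇒   : ∀ {ψ χ} → ModalFree ψ → ModalFree χ → ModalFree (ψ ⇒ χ)

rename : ∀ {l} {V W : Set} → (V → W) → Fm l V → Fm l W
rename f (var p) = var (f p)
rename f ⊥'      = ⊥'
rename f (ψ ⇒ χ) = rename f ψ ⇒ rename f χ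
rename f (◇ j ψ) = ◇ j (rename f ψ)

-- Kripke semantics in a frame (X, R_0, …, R_l), R j interprets ◇_j.
-- Truth is read classically via double negation (atoms and ◇),
-- which coincides with the usual semantics classically.
module Semantics {l : ℕ} (X : Set) (R : Fin (suc l) → X → X → Set) where

  Valuation : Set → Set₁
  Valuation V = V → X → Set

  _,_⊨_ : ∀ {V} → Valuation V → X → Fm l V → Set
  θ , a ⊨ var p   = ¬ ¬ θ p a
  θ , a ⊨ ⊥'      = ⊥
  θ , a ⊨ (ψ ⇒ χ) = θ , a ⊨ ψ → θ , a ⊨ χ
  θ , a ⊨ ◇ j ψ   = ¬ ¬ (Σ X λ b → R j a b × θ , b ⊨ ψ)

  ext : ∀ {V} → Valuation V → Fm l V → X → Set
  ext θ ψ a = θ , a ⊨ ψ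

  Valid : Fm l ℕ → Set₁
  Valid ψ = (θ : Valuation ℕ) (a : X) → θ , a ⊨ ψ

  Log : Fm l ℕ → Set₁
  Log = Valid

  Equiv₂ : Fm l (Fin 2) → Fm l (Fin 2) → Set₁
  Equiv₂ ψ χ = Log (rename toℕ (ψ ⇔' χ))

  TwoFinite : Set₁
  TwoFinite = Σ (List (Fm l (Fin 2))) λ reps →
                (ψ : Fm l (Fin 2)) → Any (Equiv₂ ψ) reps

  R-on : (X → Set) → X → X → Set
  R-on V a b = V a × R fzero a b × V b

  R*-on : (X → Set) → X → X → Set
  R*-on V = Star (R-on V)

{-# OPTIONS --safe #-}
module Submission where

-- The truth set of [◇₀^{≤n} p₁]_{p₀} is "some point of S is reachable from here in at most
-- n steps of R inside V", where p₀, p₁ define V, S. These sets grow with n, and by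
-- 2-finiteness two of the formulas, for depths i < j, are equivalent. Hence reachability
-- in i + 1 steps already implies reachability in i steps, for all definable V and S at
-- once; applied to S, ◇S, ◇◇S, … this shows that depth i captures all of R_V^*. Taking
-- S to be the complement of φ (which relativization leaves unchanged) gives the theorem.

open import Defs
open import Data.Nat using (ℕ; zero; suc; _≤′_; ≤′-refl; ≤′-step) renaming (_<_ to _<ℕ_)
open import Data.Nat.Properties using (n<1+n; z≤′n; ≤⇒≤′)
open import Data.Fin using (Fin; toℕ) renaming (zero to fzero; suc to fsuc)
open import Data.Fin.Properties using (pigeonhole)
open import Data.Product using (Σ; ∃; ∃₂; _×_; _,_)
open import Data.Empty using (⊥-elim)
open import Data.List using (length; lookup)
open import Data.List.Relation.Unary.Any using (index)
open import Data.List.Relation.Unary.Any.Properties using (lookup-index)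
open import Function using (id; _∘_)
open import Function.Bundles using (_⇔_; mk⇔; Equivalence)
open import Function.Construct.Composition using (_⇔-∘_)
open import Function.Construct.Symmetry using (⇔-sym)
open import Relation.Nullary using (¬_)
open import Relation.Nullary.Negation using (contradiction; negated-stable)
open import Relation.Unary using (_⊆_; ∁; Stable)
open import Relation.Binary.PropositionalEquality using (_≡_; refl; sym; cong; cong₂; subst; module ≡-Reasoning)
open import Relation.Binary.Construct.Closure.ReflexiveTransitive using (ε; _◅_)

open Equivalence using (to; from)

rel-modalFree : ∀ {l W} (ξ : Fm l W) {φ : Fm l W} → ModalFree φ → rel ξ φ ≡ φ
rel-modalFree ξ (mf-var p)   = refl
rel-modalFree ξ mf-⊥         = refl
rel-modalFree ξ (mf-⇒ mψ mχ) = cong₂ _⇒_ (rel-modalFree ξ mψ) (rel-modalFree ξ mχ)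

module _ {l : ℕ} (X : Set) (R : Fin (suc l) → X → X → Set) where
  open Semantics X R

  private variable
    W W' : Set
    θ : Valuation W
    ψ χ : Fm l W
    V V' S S' P : X → Set
    a b : X
    m n : ℕ

  ⊨-stable : (θ : Valuation W) (ψ : Fm l W) → Stable (ext θ ψ)
  ⊨-stable θ (var p) a = negated-stable
  ⊨-stable θ ⊥'      a h = h id
  ⊨-stable θ (ψ ⇒ χ) a h x = ⊨-stable θ χ a λ ¬y → h λ f → ¬y (f x)
  ⊨-stable θ (◇ j ψ) a = negated-stable

  ⊨-rename : (f : W → W') (θ : Valuation W') (ψ : Fm l W) (a : X) →
             (θ , a ⊨ rename f ψ) ⇔ ((θ ∘ f) , a ⊨ ψ)
  ⊨-rename f θ (var p) a = mk⇔ id id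
  ⊨-rename f θ ⊥'      a = mk⇔ id id
  ⊨-rename f θ (ψ ⇒ χ) a =
    mk⇔ (λ h x → to   (⊨-rename f θ χ a) (h (from (⊨-rename f θ ψ a) x)))
        (λ h x → from (⊨-rename f θ χ a) (h (to   (⊨-rename f θ ψ a) x)))
  ⊨-rename f θ (◇ j ψ) a =
    mk⇔ (λ h k → h λ { (b , r , s) → k (b , r , to   (⊨-rename f θ ψ b) s) })
        (λ h k → h λ { (b , r , s) → k (b , r , from (⊨-rename f θ ψ b) s) })

  ⊨-⇔' : θ , a ⊨ (ψ ⇔' χ) → (θ , a ⊨ ψ) ⇔ (θ , a ⊨ χ)
  ⊨-⇔' {θ = θ} {a = a} {ψ = ψ} {χ = χ} h =
    mk⇔ (λ x → ⊨-stable θ χ a λ ¬y → h λ f _ → ¬y (f x))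
        (λ y → ⊨-stable θ ψ a λ ¬x → h λ _ g → ¬x (g y))

  Equiv₂⇒⇔ : {ψ χ : Fm l (Fin 2)} → Equiv₂ ψ χ →
             (θ : Valuation ℕ) (a : X) → ((θ ∘ toℕ) , a ⊨ ψ) ⇔ ((θ ∘ toℕ) , a ⊨ χ)
  Equiv₂⇒⇔ {ψ} {χ} eq θ a = ⊨-⇔' (to (⊨-rename toℕ θ (ψ ⇔' χ) a) (eq θ a))

  -- Definitionally the truth set of ◇₀ (ξ ∧' χ) when ξ, χ define V, S.
  ◇-on : (X → Set) → (X → Set) → X → Set
  ◇-on V S a = ¬ ¬ (Σ X λ b → R fzero a b × ¬ (V b → ¬ S b))

  ◇-on^ : (X → Set) → ℕ → (X → Set) → X → Set
  ◇-on^ V zero    S = S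
  ◇-on^ V (suc i) S = ◇-on^ V i (◇-on V S)

  ◇-on≤ : (X → Set) → ℕ → (X → Set) → X → Set
  ◇-on≤ V zero    S   = S
  ◇-on≤ V (suc n) S a = ¬ ◇-on≤ V n S a → ◇-on^ V (suc n) S a

  ⊨-rel-◇₀^ : (θ : Valuation W) (ξ : Fm l W) (i : ℕ) (ψ : Fm l W) (a : X) →
              θ , a ⊨ rel ξ (◇₀^ i ψ) ≡ ◇-on^ (ext θ ξ) i (ext θ (rel ξ ψ)) a
  ⊨-rel-◇₀^ θ ξ zero    ψ a = refl
  ⊨-rel-◇₀^ θ ξ (suc i) ψ a = ⊨-rel-◇₀^ θ ξ i (◇ fzero ψ) a

  ⊨-rel-◇₀≤ : (θ : Valuation W) (ξ : Fm l W) (n : ℕ) (ψ : Fm l W) (a : X) →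
              θ , a ⊨ rel ξ (◇₀≤ n ψ) ≡ ◇-on≤ (ext θ ξ) n (ext θ (rel ξ ψ)) a
  ⊨-rel-◇₀≤ θ ξ zero    ψ a = refl
  ⊨-rel-◇₀≤ θ ξ (suc n) ψ a =
    cong₂ (λ A B → ¬ A → B) (⊨-rel-◇₀≤ θ ξ n ψ a) (⊨-rel-◇₀^ θ ξ (suc n) ψ a)

  ⊨-rel-□₀≤ : (θ : Valuation W) (ξ : Fm l W) (m : ℕ) {φ : Fm l W} → ModalFree φ → (a : X) →
              θ , a ⊨ rel ξ (□₀≤ m φ) ≡ (¬ ◇-on≤ (ext θ ξ) m (∁ (ext θ φ)) a)
  ⊨-rel-□₀≤ θ ξ m {φ} mf a = cong ¬_ (begin
      θ , a ⊨ rel ξ (◇₀≤ m (¬' φ))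
    ≡⟨ ⊨-rel-◇₀≤ θ ξ m (¬' φ) a ⟩
      ◇-on≤ (ext θ ξ) m (ext θ (rel ξ (¬' φ))) a
    ≡⟨ cong (λ ψ → ◇-on≤ (ext θ ξ) m (ext θ ψ) a) (rel-modalFree ξ (mf-⇒ mf mf-⊥)) ⟩
      ◇-on≤ (ext θ ξ) m (ext θ (¬' φ)) a
    ∎)
    where open ≡-Reasoning

  ◇-on-mono : V ⊆ V' → S ⊆ S' → ◇-on V S ⊆ ◇-on V' S'
  ◇-on-mono v s h k = h λ { (b , r , g) → k (b , r , λ f → g λ vb sb → f (v vb) (s sb)) }

  ◇-on^-mono : V ⊆ V' → (i : ℕ) → S ⊆ S' → ◇-on^ V i S ⊆ ◇-on^ V' i S'
  ◇-on^-mono v zero    s = s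
  ◇-on^-mono v (suc i) s = ◇-on^-mono v i (◇-on-mono v s)

  ◇-on≤-mono : V ⊆ V' → (n : ℕ) → S ⊆ S' → ◇-on≤ V n S ⊆ ◇-on≤ V' n S'
  ◇-on≤-mono v zero    s     = s
  ◇-on≤-mono v (suc n) s e k = ◇-on^-mono v (suc n) s (e λ e₀ → k (◇-on≤-mono v n s e₀))

  ◇-on≤-mono-depth : m ≤′ n → ◇-on≤ V m S ⊆ ◇-on≤ V n S
  ◇-on≤-mono-depth ≤′-refl         e   = e
  ◇-on≤-mono-depth (≤′-step m≤′n) e k = ⊥-elim (k (◇-on≤-mono-depth m≤′n e))

  ◇-on^-suc : (i : ℕ) (S : X → Set) (a : X) → ◇-on^ V (suc i) S a ≡ ◇-on V (◇-on^ V i S) a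
  ◇-on^-suc zero    S a = refl
  ◇-on^-suc {V = V} (suc i) S a = ◇-on^-suc i (◇-on V S) a

  ◇-on≤-◇-on : (n : ℕ) → ◇-on≤ V n (◇-on V S) ⊆ ◇-on≤ V (suc n) S
  ◇-on≤-◇-on zero    e _ = e
  ◇-on≤-◇-on (suc n) e k = e λ e₀ → k (◇-on≤-◇-on n e₀)

  R*-on⇒◇-on^ : R*-on V a b → S b → ∃ λ i → ◇-on^ V i S a
  R*-on⇒◇-on^ ε s = 0 , s
  R*-on⇒◇-on^ {V = V} {S = S} ((_ , r , vc) ◅ p) s =
    let i , f = R*-on⇒◇-on^ p s
    in suc i , subst id (sym (◇-on^-suc {V = V} i S _)) (λ k → k (_ , r , λ g → g vc f))

  ◇-on^⇒¬avoid : (i : ℕ) → V a → ◇-on^ V i S a → ¬ (∀ b → R*-on V a b → ¬ S b)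
  ◇-on^⇒¬avoid zero va f avoid = avoid _ ε f
  ◇-on^⇒¬avoid {V = V} {S = S} (suc i) va f avoid =
    subst id (◇-on^-suc {V = V} i S _) f λ { (_ , r , g) →
      g λ vc fc → ◇-on^⇒¬avoid i vc fc λ b p → avoid b ((va , r , vc) ◅ p) }

  ◇-on≤⇒¬avoid : (n : ℕ) → V a → ◇-on≤ V n S a → ¬ (∀ b → R*-on V a b → ¬ S b)
  ◇-on≤⇒¬avoid zero    va e       = ◇-on^⇒¬avoid 0 va e
  ◇-on≤⇒¬avoid (suc n) va e avoid =
    ◇-on^⇒¬avoid (suc n) va (e λ e₀ → ◇-on≤⇒¬avoid n va e₀ avoid) avoid

  Saturated : (X → Set) → ℕ → Set₁
  Saturated V m = ∀ {S} → Stable S → ◇-on≤ V (suc m) S ⊆ ◇-on≤ V m S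

  saturated⇒◇-on^⊆◇-on≤ : Saturated V m → Stable S → (i : ℕ) → ◇-on^ V i S ⊆ ◇-on≤ V m S
  saturated⇒◇-on^⊆◇-on≤ {V = V} {S = S} _ _ zero s = ◇-on≤-mono-depth {V = V} {S = S} z≤′n s
  saturated⇒◇-on^⊆◇-on≤ {V = V} {m = m} sat sS (suc i) f =
    sat sS (◇-on≤-◇-on {V = V} m (saturated⇒◇-on^⊆◇-on≤ sat (λ _ → negated-stable) i f))

  saturated⇒□-on≤⇔R*-on : Saturated V m → Stable P → V a →
                          (¬ ◇-on≤ V m (∁ P) a) ⇔ (∀ b → R*-on V a b → P b)
  saturated⇒□-on≤⇔R*-on {V = V} {m = m} {P = P} sat sP va = mk⇔
    (λ ¬e b p → sP b λ ¬Pb →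
      let i , f = R*-on⇒◇-on^ {S = ∁ P} p ¬Pb
      in ¬e (saturated⇒◇-on^⊆◇-on≤ sat (λ _ → negated-stable) i f))
    (λ all e → ◇-on≤⇒¬avoid {V = V} {S = ∁ P} m va e λ b p ¬Pb → ¬Pb (all b p))

  TwoFinite⇒repetition : TwoFinite → (g : ℕ → Fm l (Fin 2)) →
    ∃₂ λ i j → i <ℕ j × ∀ θ a → ((θ ∘ toℕ) , a ⊨ g i) ⇔ ((θ ∘ toℕ) , a ⊨ g j)
  TwoFinite⇒repetition (reps , classify) g =
    let class = λ (x : Fin (suc (length reps))) → index (classify (g (toℕ x)))
        i , j , i<j , same = pigeonhole (n<1+n (length reps)) class
        i∼rep = subst (Equiv₂ (g (toℕ i)) ∘ lookup reps) same (lookup-index (classify (g (toℕ i))))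
        j∼rep = lookup-index (classify (g (toℕ j)))
    in toℕ i , toℕ j , i<j , λ θ a → ⇔-sym (Equiv₂⇒⇔ j∼rep θ a) ⇔-∘ Equiv₂⇒⇔ i∼rep θ a

  [◇₀≤_p₁]p₀ : ℕ → Fm l (Fin 2)
  [◇₀≤ n p₁]p₀ = rel (var fzero) (◇₀≤ n (var (fsuc fzero)))

  valuation₂ : (X → Set) → (X → Set) → Valuation ℕ
  valuation₂ V S zero    = V
  valuation₂ V S (suc _) = S

  ⊨-[◇₀≤_p₁]p₀ : (n : ℕ) (V S : X → Set) (a : X) →
    (valuation₂ V S ∘ toℕ) , a ⊨ [◇₀≤ n p₁]p₀ ≡ ◇-on≤ (λ x → ¬ ¬ V x) n (λ x → ¬ ¬ S x) a
  ⊨-[◇₀≤ n p₁]p₀ V S = ⊨-rel-◇₀≤ (valuation₂ V S ∘ toℕ) (var fzero) n (var (fsuc fzero))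

  TwoFinite⇒saturated : TwoFinite → Σ ℕ λ m → ∀ {V} → Stable V → Saturated V m
  TwoFinite⇒saturated tf =
    let i , j , i<j , i⇔j = TwoFinite⇒repetition tf [◇₀≤_p₁]p₀
    in i , λ {V} sV {S} sS {a} e →
      -- atoms are read through ¬ ¬, so the formulas only see ¬ ¬ V and ¬ ¬ S
      let e¬¬ = ◇-on≤-mono {V = V} {S = S} contradiction (suc i) contradiction e
          ej  = ◇-on≤-mono-depth (≤⇒≤′ i<j) e¬¬
          ei  = subst id (⊨-[◇₀≤ i p₁]p₀ V S a)
                  (from (i⇔j (valuation₂ V S) a) (subst id (sym (⊨-[◇₀≤ j p₁]p₀ V S a)) ej))
      in ◇-on≤-mono (sV _) i (sS _) ei

proposition3p8 : {l : ℕ} (X : Set) (R : Fin (suc l) → X → X → Set) →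
    Semantics.TwoFinite X R →
    Σ ℕ λ m →
      (k : Card) (θ : Semantics.Valuation X R (Var k))
      (ξ φ : Fm l (Var k)) → ModalFree φ →
      (a : X) → Semantics.ext X R θ ξ a →
      (Semantics._,_⊨_ X R θ a (rel ξ (□₀≤ m φ))
        ⇔ ((b : X) → Semantics.R*-on X R (Semantics.ext X R θ ξ) a b →
             Semantics.ext X R θ φ b))
proposition3p8 X R twoFinite =
  let m , saturated = TwoFinite⇒saturated X R twoFinite
  in m , λ k θ ξ φ mf a ξa →
    subst (_⇔ _) (sym (⊨-rel-□₀≤ X R θ ξ m mf a))
      (saturated⇒□-on≤⇔R*-on X R (saturated (⊨-stable X R θ ξ)) (⊨-stable X R θ φ) ξa)
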